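{- Let $a,\delta$ be positive integers with $a<\delta<2a$ and $\gcd(a,\delta)=1$, and put $b=a+\delta$. As $q$ runs through $1,\dots,\delta-1$, the residues $\rho\equiv qa \pmod\delta$ run bijectively through $\{1,\dots,\delta-1\}$. In particular, with $w_n = n + a\lfloor n/a\rfloor + b\lfloor n/\delta\rfloor$ and $g_n=w_{n+1}-w_n$, there are exactly $\delta-1$ indices $n$ with $0\le n<a\delta$ such that $g_n=a+1$. -}

module Defs where

open import Data.Nat using (ℕ; zero; suc; _+_; _*_; _∸_; _≤_; _<_; NonZero)
open import Data.Nat.DivMod using (_/_; _%_)
open import Data.Nat.Properties using (_≟_)
open import Data.Product using (Σ; _×_; _,_)
open import Data.List using (List; length; filter; upTo)
open import Relation.Binary.PropositionalEquality using (_≡_)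
open import Relation.Nullary.Decidable using (⌊_⌋)

Range : ℕ → Set
Range m = Σ ℕ (λ x → (1 ≤ x) × (x < m))

w : (a δ b : ℕ) → .{{_ : NonZero a}} → .{{_ : NonZero δ}} → ℕ → ℕ
w a δ b n = n + a * (n / a) + b * (n / δ)

-- g_n = w_{n+1} - w_n  (w is nondecreasing, so truncated subtraction is exact)
g : (a δ b : ℕ) → .{{_ : NonZero a}} → .{{_ : NonZero δ}} → ℕ → ℕ
g a δ b n = w a δ b (suc n) ∸ w a δ b n

countGaps : (a δ : ℕ) → .{{_ : NonZero a}} → .{{_ : NonZero δ}} → ℕ
countGaps a δ = length (filter (λ n → g a δ (a + δ) n ≟ suc a) (upTo (a * δ)))

-- Bézout gives an inverse of a modulo δ, so q ↦ q a mod δ can be undone and permutes the nonzero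
-- residues. For the count, ⌊(n+1)/d⌋ − ⌊n/d⌋ is 1 when d ∣ n+1 and 0 otherwise, hence
-- g_n = 1 + a [a ∣ n+1] + b [δ ∣ n+1], and g_n = a + 1 exactly when a ∣ n+1 but δ ∤ n+1.
-- Among 1 ≤ n+1 ≤ aδ there are δ multiples of a, and by coprimality only the last one, aδ,
-- is a multiple of δ.
module Submission where

open import Defs
open import Data.Nat using (ℕ; zero; suc; pred; _+_; _*_; _∸_; _<_; s≤s; NonZero; ≢-nonZero⁻¹; >-nonZero⁻¹)
open import Data.Nat.DivMod
open import Data.Nat.GCD using (gcd; module Bézout)
open import Data.Nat.Coprimality using (Coprime; gcd≡1⇒coprime; coprime-Bézout; coprime-divisor)
  renaming (sym to coprime-sym)
open import Data.Nat.Divisibility using (_∣_; divides; _∣?_; n∣m⇒m%n≡0; ∣⇒≤)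
open import Data.Nat.Properties
open import Data.Nat.Tactic.RingSolver using (solve-∀)
open import Data.Product using (Σ; ∃; _×_; _,_; proj₁; proj₂)
open import Data.List using (length; filter; upTo; [_]; _++_)
open import Data.List.Properties using (upTo-∷ʳ; filter-++; length-++; filter-accept; filter-reject)
open import Function using (_∘_)
open import Function.Bundles using (_⤖_; _⇔_; Bijection; Equivalence; mk⇔; mk↔ₛ′)
open import Function.Properties.Inverse using (↔⇒⤖)
open import Relation.Nullary using (¬_; yes; no; contradiction)
open import Relation.Unary using (Pred; Decidable)
open import Relation.Binary.PropositionalEquality hiding ([_])
open ≡-Reasoning

module _ {m : ℕ} .{{_ : NonZero m}} where

  [x%m*y]%m≡[x*y]%m : ∀ x y → x % m * y % m ≡ x * y % m
  [x%m*y]%m≡[x*y]%m x y = begin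
    x % m * y % m            ≡⟨ %-distribˡ-* (x % m) y m ⟩
    x % m % m * (y % m) % m  ≡⟨ cong (λ t → t * (y % m) % m) (m%n%n≡m%n x m) ⟩
    x % m * (y % m) % m      ≡⟨ %-distribˡ-* x y m ⟨
    x * y % m                ∎

  [x*y%m]%m≡[x*y]%m : ∀ x y → x * (y % m) % m ≡ x * y % m
  [x*y%m]%m≡[x*y]%m x y = begin
    x * (y % m) % m  ≡⟨ cong (_% m) (*-comm x (y % m)) ⟩
    y % m * x % m    ≡⟨ [x%m*y]%m≡[x*y]%m y x ⟩
    y * x % m        ≡⟨ cong (_% m) (*-comm y x) ⟩
    x * y % m        ∎

  %-*-cancelʳ : ∀ {c c'} q → c' * c % m ≡ 1 % m → q * c % m * c' % m ≡ q % m
  %-*-cancelʳ {c} {c'} q c'c≡1 = begin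
    q * c % m * c' % m    ≡⟨ [x%m*y]%m≡[x*y]%m (q * c) c' ⟩
    q * c * c' % m        ≡⟨ cong (_% m) (trans (*-assoc q c c') (cong (q *_) (*-comm c c'))) ⟩
    q * (c' * c) % m      ≡⟨ [x*y%m]%m≡[x*y]%m q (c' * c) ⟨
    q * (c' * c % m) % m  ≡⟨ cong (λ t → q * t % m) c'c≡1 ⟩
    q * (1 % m) % m       ≡⟨ [x*y%m]%m≡[x*y]%m q 1 ⟩
    q * 1 % m             ≡⟨ cong (_% m) (*-identityʳ q) ⟩
    q % m                 ∎

  inverse-mod : ∀ {c} → Coprime c m → ∃ λ c' → c' * c % m ≡ 1 % m
  inverse-mod {c} coprime with coprime-Bézout coprime
  ... | Bézout.+- x y 1+ym≡xc = x , (begin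
    x * c % m        ≡⟨ cong (_% m) 1+ym≡xc ⟨
    (1 + y * m) % m  ≡⟨ [m+kn]%n≡m%n 1 y m ⟩
    1 % m            ∎)
  -- here x c ≡ −1 (mod m), so (m − 1) x is an inverse
  ... | Bézout.-+ x y 1+xc≡ym = pred m * x , (begin
    pred m * x * c % m                   ≡⟨ [m+n]%n≡m%n (pred m * x * c) m ⟨
    (pred m * x * c + m) % m             ≡⟨ cong (λ t → (pred m * x * c + t) % m) (suc-pred m) ⟨
    (pred m * x * c + suc (pred m)) % m  ≡⟨ cong (_% m) (expand (pred m) x c) ⟩
    (1 + pred m * (1 + x * c)) % m       ≡⟨ cong (λ t → (1 + pred m * t) % m) 1+xc≡ym ⟩
    (1 + pred m * (y * m)) % m           ≡⟨ cong (λ t → (1 + t) % m) (*-assoc (pred m) y m) ⟨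
    (1 + pred m * y * m) % m             ≡⟨ [m+kn]%n≡m%n 1 (pred m * y) m ⟩
    1 % m                                ∎)
    where
    expand : ∀ e x c → e * x * c + suc e ≡ 1 + e * (1 + x * c)
    expand = solve-∀

Range-≡ : ∀ {m} {x y : Range m} → proj₁ x ≡ proj₁ y → x ≡ y
Range-≡ {x = x , 1≤x , x<m} {.x , 1≤x′ , x<m′} refl =
  cong₂ (λ p q → x , p , q) (≤-irrelevant 1≤x 1≤x′) (<-irrelevant x<m x<m′)

module _ {m : ℕ} .{{_ : NonZero m}} where

  *%-Range : ∀ c c' → c' * c % m ≡ 1 % m → Range m → Range m
  *%-Range c c' c'c≡1 (q , 1≤q , q<m) = q * c % m , n≢0⇒n>0 qc%m≢0 , m%n<n (q * c) m
    where
    qc%m≢0 : q * c % m ≢ 0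
    qc%m≢0 qc%m≡0 = <⇒≢ 1≤q (begin
      0                   ≡⟨ m*n%n≡0 0 m ⟨
      0 * c' % m          ≡⟨ cong (λ t → t * c' % m) qc%m≡0 ⟨
      q * c % m * c' % m  ≡⟨ %-*-cancelʳ q c'c≡1 ⟩
      q % m               ≡⟨ m<n⇒m%n≡m q<m ⟩
      q                   ∎)

  *%-Range-inverse : ∀ c c' (c'c≡1 : c' * c % m ≡ 1 % m) (cc'≡1 : c * c' % m ≡ 1 % m) x →
                     *%-Range c' c cc'≡1 (*%-Range c c' c'c≡1 x) ≡ x
  *%-Range-inverse c c' c'c≡1 _ (q , _ , q<m) = Range-≡ (trans (%-*-cancelʳ q c'c≡1) (m<n⇒m%n≡m q<m))

  *%-Range-⤖ : ∀ {c} → Coprime c m →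
               Σ (Range m ⤖ Range m) λ f → ∀ q → proj₁ (Bijection.to f q) ≡ proj₁ q * c % m
  *%-Range-⤖ {c} coprime with inverse-mod coprime
  ... | c' , c'c≡1 = ↔⇒⤖ (mk↔ₛ′ (*%-Range c c' c'c≡1) (*%-Range c' c cc'≡1)
                                 (*%-Range-inverse c' c cc'≡1 c'c≡1) (*%-Range-inverse c c' c'c≡1 cc'≡1))
                   , λ _ → refl
    where
    cc'≡1 : c * c' % m ≡ 1 % m
    cc'≡1 = trans (cong (_% m) (*-comm c c')) c'c≡1

coprime-∣⇒*∣ : ∀ {m n o} → Coprime m n → m ∣ o → n ∣ o → m * n ∣ o
coprime-∣⇒*∣ {m} {n} {o} coprime (divides k o≡km) n∣o
  with coprime-divisor (coprime-sym coprime) (subst (n ∣_) (trans o≡km (*-comm k m)) n∣o)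
... | divides l k≡ln = divides l (begin
  o            ≡⟨ o≡km ⟩
  k * m        ≡⟨ cong (_* m) k≡ln ⟩
  l * n * m    ≡⟨ *-assoc l n m ⟩
  l * (n * m)  ≡⟨ cong (l *_) (*-comm n m) ⟩
  l * (m * n)  ∎)

module _ (d : ℕ) .{{_ : NonZero d}} {n : ℕ} where

  /-suc-∣ : d ∣ suc n → suc n / d ≡ suc (n / d)
  /-suc-∣ d∣1+n = begin
    suc n / d                      ≡⟨ /-congˡ (cong suc (m≡m%n+[m/n]*n n d)) ⟩
    (suc (n % d) + n / d * d) / d  ≡⟨ /-congˡ (cong (_+ n / d * d) 1+n%d≡d) ⟩
    (d + n / d * d) / d            ≡⟨ m*n/n≡m (suc (n / d)) d ⟩
    suc (n / d)                    ∎
    where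
    1+n%d≡d : suc (n % d) ≡ d
    1+n%d≡d = trans (cong suc (%-pred-≡0 (n∣m⇒m%n≡0 (suc n) d d∣1+n))) (m+[n∸m]≡n (>-nonZero⁻¹ d))

  /-suc-∤ : ¬ d ∣ suc n → suc n / d ≡ n / d
  /-suc-∤ d∤1+n = begin
    suc n / d                        ≡⟨ /-congˡ 1+n≡1+n%d+[n/d]*d ⟩
    (suc (n % d) + n / d * d) / d    ≡⟨ +-distrib-/-∣ʳ (suc (n % d)) (divides (n / d) refl) ⟩
    suc (n % d) / d + n / d * d / d  ≡⟨ cong₂ _+_ (m<n⇒m/n≡0 1+n%d<d) (m*n/n≡m (n / d) d) ⟩
    n / d                            ∎
    where
    1+n≡1+n%d+[n/d]*d : suc n ≡ suc (n % d) + n / d * d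
    1+n≡1+n%d+[n/d]*d = cong suc (m≡m%n+[m/n]*n n d)
    1+n%d<d : suc (n % d) < d
    1+n%d<d = ≤∧≢⇒< (m%n<n n d) λ 1+n%d≡d →
      d∤1+n (divides (suc (n / d)) (trans 1+n≡1+n%d+[n/d]*d (cong (_+ n / d * d) 1+n%d≡d)))

module _ (a δ b : ℕ) .{{_ : NonZero a}} .{{_ : NonZero δ}} (n : ℕ) where

  g-step : ∀ i j → suc n / a ≡ i + n / a → suc n / δ ≡ j + n / δ → g a δ b n ≡ suc (i * a + j * b)
  g-step i j /a-step /δ-step = begin
    w a δ b (suc n) ∸ w a δ b n                  ≡⟨ cong (_∸ w a δ b n) w-step ⟩
    w a δ b n + suc (i * a + j * b) ∸ w a δ b n  ≡⟨ m+n∸m≡n (w a δ b n) _ ⟩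
    suc (i * a + j * b)                          ∎
    where
    regroup : ∀ n a b i j x y → suc n + a * (i + x) + b * (j + y) ≡ n + a * x + b * y + suc (i * a + j * b)
    regroup = solve-∀
    w-step : w a δ b (suc n) ≡ w a δ b n + suc (i * a + j * b)
    w-step = begin
      suc n + a * (suc n / a) + b * (suc n / δ)  ≡⟨ cong₂ (λ x y → suc n + a * x + b * y) /a-step /δ-step ⟩
      suc n + a * (i + n / a) + b * (j + n / δ)  ≡⟨ regroup n a b i j (n / a) (n / δ) ⟩
      w a δ b n + suc (i * a + j * b)            ∎

module _ (a δ : ℕ) .{{_ : NonZero a}} .{{_ : NonZero δ}} where

  1+i*a+1*[a+δ]≢1+a : ∀ i → suc (i * a + 1 * (a + δ)) ≢ suc a
  1+i*a+1*[a+δ]≢1+a i eq = <⇒≢ a<i*a+1*[a+δ] (sym (suc-injective eq))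
    where
    a<i*a+1*[a+δ] : a < i * a + 1 * (a + δ)
    a<i*a+1*[a+δ] = <-≤-trans (m<m+n a (>-nonZero⁻¹ δ))
                              (≤-trans (≤-reflexive (sym (*-identityˡ (a + δ)))) (m≤n+m _ (i * a)))

  g≡1+a⇔ : ∀ n → g a δ (a + δ) n ≡ suc a ⇔ (a ∣ suc n × ¬ δ ∣ suc n)
  g≡1+a⇔ n with a ∣? suc n | δ ∣? suc n
  ... | yes a∣1+n | no δ∤1+n = mk⇔ (λ _ → a∣1+n , δ∤1+n) λ _ →
    trans (g-step a δ (a + δ) n 1 0 (/-suc-∣ a a∣1+n) (/-suc-∤ δ δ∤1+n))
          (cong suc (trans (+-identityʳ _) (+-identityʳ a)))
  ... | yes a∣1+n | yes δ∣1+n = mk⇔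
    (λ gap → contradiction (trans (sym (g-step a δ (a + δ) n 1 1 (/-suc-∣ a a∣1+n) (/-suc-∣ δ δ∣1+n))) gap)
                           (1+i*a+1*[a+δ]≢1+a 1))
    (λ (_ , δ∤1+n) → contradiction δ∣1+n δ∤1+n)
  ... | no a∤1+n | yes δ∣1+n = mk⇔
    (λ gap → contradiction (trans (sym (g-step a δ (a + δ) n 0 1 (/-suc-∤ a a∤1+n) (/-suc-∣ δ δ∣1+n))) gap)
                           (1+i*a+1*[a+δ]≢1+a 0))
    (λ (a∣1+n , _) → contradiction a∣1+n a∤1+n)
  ... | no a∤1+n | no δ∤1+n = mk⇔
    (λ gap → contradiction (suc-injective (trans (sym (g-step a δ (a + δ) n 0 0 (/-suc-∤ a a∤1+n) (/-suc-∤ δ δ∤1+n))) gap))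
                           (≢-nonZero⁻¹ a ∘ sym))
    (λ (a∣1+n , _) → contradiction a∣1+n a∤1+n)

module _ {p} {P : Pred ℕ p} (P? : Decidable P) where

  countBelow : ℕ → ℕ
  countBelow N = length (filter P? (upTo N))

  countBelow-suc : ∀ N → countBelow (suc N) ≡ countBelow N + length (filter P? [ N ])
  countBelow-suc N = begin
    length (filter P? (upTo (suc N)))              ≡⟨ cong (length ∘ filter P?) (upTo-∷ʳ N) ⟨
    length (filter P? (upTo N ++ [ N ]))            ≡⟨ cong length (filter-++ P? (upTo N) [ N ]) ⟩
    length (filter P? (upTo N) ++ filter P? [ N ])  ≡⟨ length-++ (filter P? (upTo N)) ⟩
    countBelow N + length (filter P? [ N ])         ∎

  countBelow-accept : ∀ {N} → P N → countBelow (suc N) ≡ suc (countBelow N)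
  countBelow-accept {N} pN = begin
    countBelow (suc N)                       ≡⟨ countBelow-suc N ⟩
    countBelow N + length (filter P? [ N ])  ≡⟨ cong (λ xs → countBelow N + length xs) (filter-accept P? pN) ⟩
    countBelow N + 1                         ≡⟨ +-comm (countBelow N) 1 ⟩
    suc (countBelow N)                       ∎

  countBelow-reject : ∀ {N} → ¬ P N → countBelow (suc N) ≡ countBelow N
  countBelow-reject {N} ¬pN = begin
    countBelow (suc N)                       ≡⟨ countBelow-suc N ⟩
    countBelow N + length (filter P? [ N ])  ≡⟨ cong (λ xs → countBelow N + length xs) (filter-reject P? ¬pN) ⟩
    countBelow N + 0                         ≡⟨ +-identityʳ (countBelow N) ⟩
    countBelow N                             ∎

countBelow-cong : ∀ {p q} {P : Pred ℕ p} {Q : Pred ℕ q} (P? : Decidable P) (Q? : Decidable Q) {N} →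
                  (∀ {n} → n < N → P n ⇔ Q n) → countBelow P? N ≡ countBelow Q? N
countBelow-cong P? Q? {zero} _ = refl
countBelow-cong P? Q? {suc N} P⇔Q with P? N
... | yes pN = begin
  countBelow P? (suc N)  ≡⟨ countBelow-accept P? pN ⟩
  suc (countBelow P? N)  ≡⟨ cong suc (countBelow-cong P? Q? (P⇔Q ∘ m<n⇒m<1+n)) ⟩
  suc (countBelow Q? N)  ≡⟨ countBelow-accept Q? (Equivalence.to (P⇔Q (n<1+n N)) pN) ⟨
  countBelow Q? (suc N)  ∎
... | no ¬pN = begin
  countBelow P? (suc N)  ≡⟨ countBelow-reject P? ¬pN ⟩
  countBelow P? N        ≡⟨ countBelow-cong P? Q? (P⇔Q ∘ m<n⇒m<1+n) ⟩
  countBelow Q? N        ≡⟨ countBelow-reject Q? (¬pN ∘ Equivalence.from (P⇔Q (n<1+n N))) ⟨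
  countBelow Q? (suc N)  ∎

countBelow-multiples : ∀ d .{{_ : NonZero d}} N → countBelow (λ n → d ∣? suc n) N ≡ N / d
countBelow-multiples d zero = sym (0/n≡0 d)
countBelow-multiples d (suc N) with d ∣? suc N
... | yes d∣1+N = begin
  countBelow (λ n → d ∣? suc n) (suc N)  ≡⟨ countBelow-accept (λ n → d ∣? suc n) d∣1+N ⟩
  suc (countBelow (λ n → d ∣? suc n) N)  ≡⟨ cong suc (countBelow-multiples d N) ⟩
  suc (N / d)                            ≡⟨ /-suc-∣ d d∣1+N ⟨
  suc N / d                              ∎
... | no d∤1+N = begin
  countBelow (λ n → d ∣? suc n) (suc N)  ≡⟨ countBelow-reject (λ n → d ∣? suc n) d∤1+N ⟩
  countBelow (λ n → d ∣? suc n) N        ≡⟨ countBelow-multiples d N ⟩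
  N / d                                  ≡⟨ /-suc-∤ d d∤1+N ⟨
  suc N / d                              ∎

countGaps≡δ∸1 : ∀ a δ .{{_ : NonZero a}} .{{_ : NonZero δ}} → Coprime a δ → countGaps a δ ≡ δ ∸ 1
countGaps≡δ∸1 a δ coprime = begin
  countGaps a δ                         ≡⟨ cong (countBelow gap?) 1+M≡aδ ⟨
  countBelow gap? (suc M)               ≡⟨ countBelow-reject gap? (λ gap → proj₂ (Equivalence.to (g≡1+a⇔ a δ M) gap) δ∣1+M) ⟩
  countBelow gap? M                     ≡⟨ countBelow-cong gap? (λ n → a ∣? suc n) gap⇔a∣ ⟩
  countBelow (λ n → a ∣? suc n) M       ≡⟨ countBelow-multiples a M ⟩
  suc (M / a) ∸ 1                       ≡⟨ cong (_∸ 1) (/-suc-∣ a a∣1+M) ⟨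
  suc M / a ∸ 1                         ≡⟨ cong (λ k → k / a ∸ 1) (trans 1+M≡aδ (*-comm a δ)) ⟩
  δ * a / a ∸ 1                         ≡⟨ cong (_∸ 1) (m*n/n≡m δ a) ⟩
  δ ∸ 1                                 ∎
  where
  gap? : Decidable (λ n → g a δ (a + δ) n ≡ suc a)
  gap? n = g a δ (a + δ) n ≟ suc a
  M : ℕ
  M = pred (a * δ)
  1+M≡aδ : suc M ≡ a * δ
  1+M≡aδ = suc-pred (a * δ) {{m*n≢0 a δ}}
  a∣1+M : a ∣ suc M
  a∣1+M = divides δ (trans 1+M≡aδ (*-comm a δ))
  δ∣1+M : δ ∣ suc M
  δ∣1+M = divides a 1+M≡aδ
  gap⇔a∣ : ∀ {n} → n < M → g a δ (a + δ) n ≡ suc a ⇔ a ∣ suc n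
  gap⇔a∣ {n} n<M = mk⇔ (proj₁ ∘ Equivalence.to (g≡1+a⇔ a δ n)) λ a∣1+n →
    Equivalence.from (g≡1+a⇔ a δ n)
      (a∣1+n , λ δ∣1+n → <⇒≱ (subst (suc n <_) 1+M≡aδ (s≤s n<M)) (∣⇒≤ (coprime-∣⇒*∣ coprime a∣1+n δ∣1+n)))

lemma4p3 : (a δ : ℕ) → .{{_ : NonZero a}} → .{{_ : NonZero δ}} →
           a < δ → δ < 2 * a → gcd a δ ≡ 1 →
           Σ (Range δ ⤖ Range δ) (λ f →
               ∀ (q : Range δ) → proj₁ (Bijection.to f q) ≡ (proj₁ q * a) % δ)
           × countGaps a δ ≡ δ ∸ 1
lemma4p3 a δ _ _ gcd≡1 = *%-Range-⤖ coprime , countGaps≡δ∸1 a δ coprime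
  where
  coprime : Coprime a δ
  coprime = gcd≡1⇒coprime gcd≡1
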